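{- Let $u=\sigma^\infty(0)$ be the fixed point starting with $0$ of the substitution $\sigma$ on $\{0,1\}$ given by $\sigma(0)=01$, $\sigma(1)=100110$. If $u$ has a prefix of the form $vv$ with $v$ a non-empty finite word, then $|vv|=2\cdot 4^i$ for some integer $i\ge0$.
   Context: $\sigma^\infty(0)$ denotes the unique infinite word having all $\sigma^n(0)$ as prefixes; $|w|$ denotes the length of a finite word $w$. -}

module Defs where

open import Data.Nat using (ℕ; zero; suc; _+_; _*_; _^_; _<_)
open import Data.List using (List; []; _∷_; concatMap; length)
open import Data.Product using (∃)
open import Relation.Binary.PropositionalEquality using (_≡_)

data Letter : Set where
  𝟘 𝟙 : Letter

σ : Letter → List Letter
σ 𝟘 = 𝟘 ∷ 𝟙 ∷ []
σ 𝟙 = 𝟙 ∷ 𝟘 ∷ 𝟘 ∷ 𝟙 ∷ 𝟙 ∷ 𝟘 ∷ []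

σ* : List Letter → List Letter
σ* = concatMap σ

σ^_[0] : ℕ → List Letter
σ^ zero [0] = 𝟘 ∷ []
σ^ suc n [0] = σ* (σ^ n [0])

at : List Letter → ℕ → Letter
at [] _ = 𝟘
at (x ∷ xs) zero = x
at (x ∷ xs) (suc k) = at xs k

-- Since σⁿ(0) is a prefix of
-- σⁿ⁺¹(0) and |σⁿ(0)| ≥ 2ⁿ > n, the letter u(n) is the n-th letter of σⁿ(0)
-- (positions 0-indexed), with the default never used.
u : ℕ → Letter
u n = at (σ^ n [0]) n

-- u has a prefix of the form vv with |v| = m: u[k] = u[m+k] for all k < m.
HasSquarePrefix : ℕ → Set
HasSquarePrefix m = ∀ k → k < m → u k ≡ u (m + k)

-- With the Thue–Morse morphism μ(x) = x x̄ and ρ(x) = x x̄ x x̄ one has σ ∘ μ = μ ∘ ρ,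
-- so u = μ(w) for the fixed point w = ρ^∞(0).  Hence u(2q + r) and w(4q + r) are
-- determined by w(q).  A square prefix of w of length p ≡ 0 (mod 4) shrinks to one of
-- length p/4; for p ≢ 0 (mod 4) with p ≠ 2, two suitably chosen positions of the
-- square force w(q') = w̄(q') or 0 = 1.  Likewise an even square prefix of u has a square
-- prefix of w of half its length, while an odd one is impossible.  So |v| = 2·4^i for w
-- and |v| = 4^(i+1) for u.
module Submission where

open import Defs
open import Data.Nat
  using ( ℕ; zero; suc; _+_; _*_; _^_; _≤_; _<_; _≤′_; ≤′-reflexive; ≤′-step
        ; z≤n; s≤s; z<s; s<s; NonZero)
open import Data.Nat.Properties
open import Data.Nat.Induction using (<-wellFounded)
open import Data.Nat.DivMod using (_divMod_; result)
open import Data.Fin using (Fin; zero; suc; toℕ; #_)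
open import Data.Fin.Properties using (toℕ<n)
open import Data.List using (List; []; _∷_; _++_; length; concatMap)
open import Data.List.Properties using (length-++; ++-assoc; ++-identityʳ; concatMap-++)
open import Data.Product using (∃; _,_)
open import Data.Sum using (inj₁; inj₂)
open import Data.Empty using (⊥-elim)
open import Induction.WellFounded using (Acc; acc)
open import Relation.Binary.PropositionalEquality
  using (_≡_; _≢_; refl; sym; trans; cong; cong₂; subst; module ≡-Reasoning)
open import Algebra.Properties.CommutativeSemigroup +-commutativeSemigroup using (x∙yz≈y∙xz)

Substitution : Set
Substitution = Letter → List Letter

iter : Substitution → ℕ → List Letter
iter τ zero = 𝟘 ∷ []
iter τ (suc n) = concatMap τ (iter τ n)

fixpoint : Substitution → ℕ → Letter
fixpoint τ n = at (iter τ n) n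

record Prolongable (τ : Substitution) : Set where
  field
    starts-with-𝟘 : ∃ λ t → τ 𝟘 ≡ 𝟘 ∷ t
    expanding : ∀ x → 2 ≤ length (τ x)

Uniform : ℕ → Substitution → Set
Uniform k τ = ∀ x → length (τ x) ≡ k

at-++ˡ : ∀ xs ys {n} → n < length xs → at (xs ++ ys) n ≡ at xs n
at-++ˡ (x ∷ xs) ys {zero} _ = refl
at-++ˡ (x ∷ xs) ys {suc n} (s≤s n<∣xs∣) = at-++ˡ xs ys n<∣xs∣

at-++ʳ : ∀ xs ys n → at (xs ++ ys) (length xs + n) ≡ at ys n
at-++ʳ [] ys n = refl
at-++ʳ (x ∷ xs) ys n = at-++ʳ xs ys n

at-concatMap : ∀ {k φ} → Uniform k φ → ∀ xs (r : Fin k) q → q < length xs →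
               at (concatMap φ xs) (toℕ r + q * k) ≡ at (φ (at xs q)) (toℕ r)
at-concatMap {k} {φ} uniform (x ∷ xs) r zero _ = begin
  at (φ x ++ φ* xs) (toℕ r + 0) ≡⟨ cong (at (φ x ++ φ* xs)) (+-identityʳ (toℕ r)) ⟩
  at (φ x ++ φ* xs) (toℕ r)     ≡⟨ at-++ˡ (φ x) (φ* xs) r<∣φx∣ ⟩
  at (φ x) (toℕ r)              ∎
  where
  open ≡-Reasoning
  φ* = concatMap φ
  r<∣φx∣ : toℕ r < length (φ x)
  r<∣φx∣ = subst (toℕ r <_) (sym (uniform x)) (toℕ<n r)
at-concatMap {k} {φ} uniform (x ∷ xs) r (suc q) (s≤s q<∣xs∣) = begin
  at (φ x ++ φ* xs) (toℕ r + (k + q * k))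
    ≡⟨ cong (at (φ x ++ φ* xs)) (x∙yz≈y∙xz (toℕ r) k (q * k)) ⟩
  at (φ x ++ φ* xs) (k + (toℕ r + q * k))
    ≡⟨ cong (λ l → at (φ x ++ φ* xs) (l + (toℕ r + q * k))) (uniform x) ⟨
  at (φ x ++ φ* xs) (length (φ x) + (toℕ r + q * k))
    ≡⟨ at-++ʳ (φ x) (φ* xs) (toℕ r + q * k) ⟩
  at (φ* xs) (toℕ r + q * k)
    ≡⟨ at-concatMap uniform xs r q q<∣xs∣ ⟩
  at (φ (at xs q)) (toℕ r)
    ∎
  where
  open ≡-Reasoning
  φ* = concatMap φ

module _ {τ : Substitution} (τ-prolongable : Prolongable τ) where
  open Prolongable τ-prolongable

  length-concatMap-≥ : ∀ xs → 2 * length xs ≤ length (concatMap τ xs)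
  length-concatMap-≥ [] = z≤n
  length-concatMap-≥ (x ∷ xs) = begin
    2 * suc (length xs)                    ≡⟨ *-suc 2 (length xs) ⟩
    2 + 2 * length xs                      ≤⟨ +-mono-≤ (expanding x) (length-concatMap-≥ xs) ⟩
    length (τ x) + length (concatMap τ xs) ≡⟨ length-++ (τ x) ⟨
    length (τ x ++ concatMap τ xs)         ∎
    where open ≤-Reasoning

  n<length-iter : ∀ n → n < length (iter τ n)
  n<length-iter zero = z<s
  n<length-iter (suc n) = begin-strict
    suc n                   <⟨ m<m*n (suc n) 2 ≤-refl ⟩
    suc n * 2               ≡⟨ *-comm (suc n) 2 ⟩
    2 * suc n               ≤⟨ *-monoʳ-≤ 2 (n<length-iter n) ⟩
    2 * length (iter τ n)   ≤⟨ length-concatMap-≥ (iter τ n) ⟩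
    length (iter τ (suc n)) ∎
    where open ≤-Reasoning

  iter-suc-extends : ∀ n → ∃ λ ys → iter τ (suc n) ≡ iter τ n ++ ys
  iter-suc-extends zero with starts-with-𝟘
  ... | t , τ𝟘≡𝟘∷t = t ++ [] , cong (_++ []) τ𝟘≡𝟘∷t
  iter-suc-extends (suc n) with iter-suc-extends n
  ... | ys , eq = concatMap τ ys , trans (cong (concatMap τ) eq) (concatMap-++ τ (iter τ n) ys)

  iter-extends : ∀ {m n} → m ≤′ n → ∃ λ ys → iter τ n ≡ iter τ m ++ ys
  iter-extends (≤′-reflexive refl) = [] , sym (++-identityʳ _)
  iter-extends {m} (≤′-step {n} m≤′n) with iter-extends m≤′n | iter-suc-extends n
  ... | ys , eq | zs , eq′ = ys ++ zs , (begin
    iter τ (suc n)         ≡⟨ eq′ ⟩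
    iter τ n ++ zs         ≡⟨ cong (_++ zs) eq ⟩
    (iter τ m ++ ys) ++ zs ≡⟨ ++-assoc (iter τ m) ys zs ⟩
    iter τ m ++ (ys ++ zs) ∎)
    where open ≡-Reasoning

  at-iter-≤ : ∀ {m n i} → m ≤ n → i < length (iter τ m) → at (iter τ n) i ≡ at (iter τ m) i
  at-iter-≤ {m} {n} {i} m≤n i<∣τᵐ∣ with iter-extends (≤⇒≤′ m≤n)
  ... | ys , eq = trans (cong (λ xs → at xs i) eq) (at-++ˡ (iter τ m) ys i<∣τᵐ∣)

  at-iter : ∀ m {i} → i < length (iter τ m) → at (iter τ m) i ≡ fixpoint τ i
  at-iter m {i} i<∣τᵐ∣ with ≤-total m i
  ... | inj₁ m≤i = sym (at-iter-≤ m≤i i<∣τᵐ∣)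
  ... | inj₂ i≤m = at-iter-≤ i≤m (n<length-iter i)

fixpoint-image : ∀ {τ ρ φ k} .{{_ : NonZero k}} →
                 Prolongable τ → Prolongable ρ → Uniform k φ →
                 (∀ n → iter τ (suc n) ≡ concatMap φ (iter ρ n)) →
                 ∀ (r : Fin k) q → fixpoint τ (toℕ r + q * k) ≡ at (φ (fixpoint ρ q)) (toℕ r)
fixpoint-image {τ} {ρ} {φ} {k} τ-prolongable ρ-prolongable φ-uniform τ≡φ*ρ r q = begin
  fixpoint τ N
    ≡⟨ at-iter τ-prolongable (suc N) N<∣τᴺ⁺¹∣ ⟨
  at (iter τ (suc N)) N
    ≡⟨ cong (λ xs → at xs N) (τ≡φ*ρ N) ⟩
  at (concatMap φ (iter ρ N)) N
    ≡⟨ at-concatMap φ-uniform (iter ρ N) r q q<∣ρᴺ∣ ⟩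
  at (φ (at (iter ρ N) q)) (toℕ r)
    ≡⟨ cong (λ x → at (φ x) (toℕ r)) (at-iter ρ-prolongable N q<∣ρᴺ∣) ⟩
  at (φ (fixpoint ρ q)) (toℕ r)
    ∎
  where
  open ≡-Reasoning
  N = toℕ r + q * k
  N<∣τᴺ⁺¹∣ : N < length (iter τ (suc N))
  N<∣τᴺ⁺¹∣ = <-trans (n<1+n N) (n<length-iter τ-prolongable (suc N))
  q<∣ρᴺ∣ : q < length (iter ρ N)
  q<∣ρᴺ∣ = ≤-<-trans (≤-trans (m≤m*n q k) (m≤n+m (q * k) (toℕ r)))
                     (n<length-iter ρ-prolongable N)

SquarePrefix : (ℕ → Letter) → ℕ → Set
SquarePrefix x p = ∀ k → k < p → x k ≡ x (p + k)

-- The length is written k + suc n so that k < p is free and, when p = r + q * 4,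
-- k + p reduces to the form r′ + q′ * 4 expected by the digit lemmas below.
square-at : ∀ {x} k {n} → SquarePrefix x (k + suc n) → x k ≡ x (k + (k + suc n))
square-at {x} k {n} sq = trans (sq k (m<m+n k z<s)) (cong x (+-comm (k + suc n) k))

square-decimate : ∀ {x y k p} .{{_ : NonZero k}} → (∀ n → x (n * k) ≡ y n) →
                  SquarePrefix x (p * k) → SquarePrefix y p
square-decimate {x} {y} {k} {p} x≡y sq n n<p = begin
  y n               ≡⟨ x≡y n ⟨
  x (n * k)         ≡⟨ sq (n * k) (*-monoˡ-< k n<p) ⟩
  x (p * k + n * k) ≡⟨ cong x (*-distribʳ-+ k p n) ⟨
  x ((p + n) * k)   ≡⟨ x≡y (p + n) ⟩
  y (p + n)         ∎
  where open ≡-Reasoning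

flp : Letter → Letter
flp 𝟘 = 𝟙
flp 𝟙 = 𝟘

≢flp : ∀ {x} → x ≢ flp x
≢flp {𝟘} ()
≢flp {𝟙} ()

𝟘≢𝟙 : 𝟘 ≢ 𝟙
𝟘≢𝟙 ()

μ ρ : Substitution
μ x = x ∷ flp x ∷ []
ρ x = x ∷ flp x ∷ x ∷ flp x ∷ []

prolongable-σ : Prolongable σ
prolongable-σ = record
  { starts-with-𝟘 = _ , refl
  ; expanding = λ { 𝟘 → s≤s (s≤s z≤n) ; 𝟙 → s≤s (s≤s z≤n) }
  }

prolongable-ρ : Prolongable ρ
prolongable-ρ = record { starts-with-𝟘 = _ , refl ; expanding = λ _ → s≤s (s≤s z≤n) }

σ*∘μ*≡μ*∘ρ* : ∀ xs → σ* (concatMap μ xs) ≡ concatMap μ (concatMap ρ xs)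
σ*∘μ*≡μ*∘ρ* [] = refl
σ*∘μ*≡μ*∘ρ* (x ∷ xs) = begin
  σ* (μ x ++ μ* xs)           ≡⟨ concatMap-++ σ (μ x) (μ* xs) ⟩
  σ* (μ x) ++ σ* (μ* xs)      ≡⟨ cong₂ _++_ (σ*∘μ≡μ*∘ρ x) (σ*∘μ*≡μ*∘ρ* xs) ⟩
  μ* (ρ x) ++ μ* (ρ* xs)      ≡⟨ concatMap-++ μ (ρ x) (ρ* xs) ⟨
  μ* (ρ x ++ ρ* xs)           ∎
  where
  open ≡-Reasoning
  μ* ρ* : List Letter → List Letter
  μ* = concatMap μ
  ρ* = concatMap ρ
  σ*∘μ≡μ*∘ρ : ∀ x → σ* (μ x) ≡ μ* (ρ x)
  σ*∘μ≡μ*∘ρ 𝟘 = refl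
  σ*∘μ≡μ*∘ρ 𝟙 = refl

iter-σ≡μ*-iter-ρ : ∀ n → iter σ (suc n) ≡ concatMap μ (iter ρ n)
iter-σ≡μ*-iter-ρ zero = refl
iter-σ≡μ*-iter-ρ (suc n) = trans (cong σ* (iter-σ≡μ*-iter-ρ n)) (σ*∘μ*≡μ*∘ρ* (iter ρ n))

σ^[0]≡iter-σ : ∀ n → σ^ n [0] ≡ iter σ n
σ^[0]≡iter-σ zero = refl
σ^[0]≡iter-σ (suc n) = cong σ* (σ^[0]≡iter-σ n)

ρ^∞ : ℕ → Letter
ρ^∞ = fixpoint ρ

ρ^∞-digit : ∀ (r : Fin 4) q → ρ^∞ (toℕ r + q * 4) ≡ at (ρ (ρ^∞ q)) (toℕ r)
ρ^∞-digit = fixpoint-image prolongable-ρ prolongable-ρ (λ _ → refl) (λ _ → refl)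

u-digit : ∀ (r : Fin 2) q → u (toℕ r + q * 2) ≡ at (μ (ρ^∞ q)) (toℕ r)
u-digit r q = trans (cong (λ xs → at xs N) (σ^[0]≡iter-σ N))
                    (fixpoint-image prolongable-σ prolongable-ρ (λ _ → refl) iter-σ≡μ*-iter-ρ r q)
  where N = toℕ r + q * 2

ρ^∞-square : ∀ {p} → Acc _<_ p → 0 < p → SquarePrefix ρ^∞ p → ∃ λ i → p ≡ 2 * 4 ^ i
ρ^∞-square {p} (acc rec) p>0 sq with p divMod 4
... | result zero zero refl = ⊥-elim (n≮0 p>0)
... | result (suc q) zero refl
      with ρ^∞-square (rec (m<m*n (suc q) 4 (s<s z<s))) z<s (square-decimate (ρ^∞-digit zero) sq)
...   | i , q≡2*4^i = suc i , (begin
  suc q * 4       ≡⟨ cong (_* 4) q≡2*4^i ⟩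
  2 * 4 ^ i * 4   ≡⟨ *-assoc 2 (4 ^ i) 4 ⟩
  2 * (4 ^ i * 4) ≡⟨ cong (2 *_) (*-comm (4 ^ i) 4) ⟩
  2 * 4 ^ suc i   ∎)
  where open ≡-Reasoning
ρ^∞-square _ _ sq | result zero (suc zero) refl = ⊥-elim (𝟘≢𝟙 (sq 0 z<s))
ρ^∞-square _ _ sq | result (suc q) (suc zero) refl = ⊥-elim (≢flp (trans (sym shift-3) shift-4))
  where
  shift-3 : ρ^∞ 3 ≡ ρ^∞ (2 + q)
  shift-3 = trans (square-at 3 sq) (ρ^∞-digit (# 0) (2 + q))
  shift-4 : ρ^∞ 4 ≡ flp (ρ^∞ (2 + q))
  shift-4 = trans (square-at 4 sq) (ρ^∞-digit (# 1) (2 + q))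
ρ^∞-square _ _ sq | result zero (suc (suc zero)) refl = 0 , refl
ρ^∞-square _ _ sq | result (suc q) (suc (suc zero)) refl =
  ⊥-elim (𝟘≢𝟙 (trans shift-2 (sym shift-4)))
  where
  shift-2 : ρ^∞ 2 ≡ ρ^∞ (2 + q)
  shift-2 = trans (square-at 2 sq) (ρ^∞-digit (# 0) (2 + q))
  shift-4 : ρ^∞ 4 ≡ ρ^∞ (2 + q)
  shift-4 = trans (square-at 4 sq) (ρ^∞-digit (# 2) (2 + q))
ρ^∞-square _ _ sq | result zero (suc (suc (suc zero))) refl = ⊥-elim (𝟘≢𝟙 (sq 0 z<s))
ρ^∞-square _ _ sq | result (suc q) (suc (suc (suc zero))) refl =
  ⊥-elim (≢flp (trans (sym shift-1) shift-4))
  where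
  shift-1 : ρ^∞ 1 ≡ ρ^∞ (2 + q)
  shift-1 = trans (square-at 1 sq) (ρ^∞-digit (# 0) (2 + q))
  shift-4 : ρ^∞ 4 ≡ flp (ρ^∞ (2 + q))
  shift-4 = trans (square-at 4 sq) (ρ^∞-digit (# 3) (2 + q))

u-square : ∀ {p} → 0 < p → SquarePrefix u p → ∃ λ i → p ≡ 4 ^ suc i
u-square {p} p>0 sq with p divMod 2
... | result zero zero refl = ⊥-elim (n≮0 p>0)
... | result (suc q) zero refl
      with ρ^∞-square (<-wellFounded (suc q)) z<s (square-decimate (u-digit zero) sq)
...   | i , q≡2*4^i = i , (begin
  suc q * 2       ≡⟨ cong (_* 2) q≡2*4^i ⟩
  2 * 4 ^ i * 2   ≡⟨ *-comm (2 * 4 ^ i) 2 ⟩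
  2 * (2 * 4 ^ i) ≡⟨ *-assoc 2 2 (4 ^ i) ⟨
  4 ^ suc i       ∎)
  where open ≡-Reasoning
u-square _ sq | result zero (suc zero) refl = ⊥-elim (𝟘≢𝟙 (sq 0 z<s))
u-square _ sq | result (suc q) (suc zero) refl = ⊥-elim (≢flp (trans (sym shift-1) shift-2))
  where
  shift-1 : u 1 ≡ ρ^∞ (2 + q)
  shift-1 = trans (square-at 1 sq) (u-digit (# 0) (2 + q))
  shift-2 : u 2 ≡ flp (ρ^∞ (2 + q))
  shift-2 = trans (square-at 2 sq) (u-digit (# 1) (2 + q))

lemma6p7 : (m : ℕ) → HasSquarePrefix (suc m) → ∃ λ i → 2 * suc m ≡ 2 * 4 ^ i
lemma6p7 m sq with u-square z<s sq
... | i , 1+m≡4^[1+i] = suc i , cong (2 *_) 1+m≡4^[1+i]
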